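{- There is a constant $C$ such that for every $n$ and every boolean matrix $A\in\{0,1\}^{n\times n}$, $C_\lor(\bar I\otimes A)\le C n^2$, where $\bar I$ is the $n\times n$ boolean complement of the identity matrix.
   Context: $\otimes$ is the Kronecker product: $B\otimes A$ is the $n^2\times n^2$ block matrix whose $(i,j)$ block is $b_{ij}A$. $\bar I$ is the $n\times n$ matrix with $0$ on the diagonal and $1$ elsewhere. A circuit is a directed acyclic graph whose in-degree-zero vertices are input gates and other vertices are gates of unbounded fan-in, with designated outputs; its size is its number of wires. An OR-circuit computes a boolean matrix $M=(m_{ij})$ if, with gates computing the boolean OR of their children, output $i$ computes $\bigvee_j m_{ij}x_j$. $C_\lor(M)$ is the minimum size of an OR-circuit computing $M$. -}

module Defs where

open import Data.Nat using (ℕ; zero; suc; _+_; _*_; _≤_)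
open import Data.Fin using (Fin; zero; suc; remQuot; _≟_)
open import Data.Bool using (Bool; true; false; _∧_; not)
open import Data.List using (List; length; allFin)
open import Data.Bool.ListAction using (any)
open import Data.Sum using (_⊎_; inj₁; inj₂)
open import Data.Product using (_×_; _,_; Σ)
open import Relation.Nullary.Decidable using (isYes)
open import Relation.Binary.PropositionalEquality using (_≡_)

Matrix : ℕ → ℕ → Set
Matrix r c = Fin r → Fin c → Bool

-- Kronecker product B ⊗ A : the (i,j) block (rows i*n..i*n+n-1,
-- columns j*n..) is b_ij A.  Row index r = i*n + k ↦ (i , k) via remQuot.
_⊗_ : ∀ {n} → Matrix n n → Matrix n n → Matrix (n * n) (n * n)
_⊗_ {n} B A r c with remQuot n r | remQuot n c
... | i , k | j , l = B i j ∧ A k l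

Ibar : (n : ℕ) → Matrix n n
Ibar n i j = not (isYes (i ≟ j))

-- A circuit with m input gates and g (non-input) gates, listed in
-- topological order (snoc list). Each new gate has an arbitrary list of
-- children (unbounded fan-in), each child being an input (inj₁) or an
-- earlier gate (inj₂). Within 'Circuit m g', gates are indexed by Fin g
-- with 'zero' the most recently added gate.
data Circuit (m : ℕ) : ℕ → Set where
  []  : Circuit m zero
  _▷_ : ∀ {g} → Circuit m g → List (Fin m ⊎ Fin g) → Circuit m (suc g)

Node : ℕ → ℕ → Set
Node m g = Fin m ⊎ Fin g

-- Size = number of wires = total fan-in of all gates.
size : ∀ {m g} → Circuit m g → ℕ
size []         = zero
size (c ▷ ch)   = size c + length ch

mutual
  evalGate : ∀ {m g} → Circuit m g → (Fin m → Bool) → Fin g → Bool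
  evalGate (c ▷ ch) x zero    = any (evalNode c x) ch
  evalGate (c ▷ ch) x (suc i) = evalGate c x i

  evalNode : ∀ {m g} → Circuit m g → (Fin m → Bool) → Node m g → Bool
  evalNode c x (inj₁ j) = x j
  evalNode c x (inj₂ i) = evalGate c x i

rowOr : ∀ {r m} → Matrix r m → Fin r → (Fin m → Bool) → Bool
rowOr {m = m} M i x = any (λ j → M i j ∧ x j) (allFin m)

record ORCircuit {r m : ℕ} (M : Matrix r m) : Set where
  field
    gates   : ℕ
    circuit : Circuit m gates
    output  : Fin r → Node m gates
    correct : ∀ (x : Fin m → Bool) (i : Fin r) →
              evalNode circuit x (output i) ≡ rowOr M i x

-- C∨(M) ≤ b  (C∨ is a minimum, so this says some OR-circuit computing M
-- has size ≤ b).
C∨≤ : ∀ {r m} → Matrix r m → ℕ → Set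
C∨≤ M b = Σ (ORCircuit M) λ C → size (ORCircuit.circuit C) ≤ b

-- Index the rows of Ī ⊗ A by (i , k) and the inputs by (j , l): row (i , k) is the OR of the x (j , l)
-- with A k l and j ≠ i.  Give the block indices distinct binary codes of B bits, n ≤ 2^B ≤ 4n; then
-- j ≠ i iff the codes differ in some bit b.  With W l b d the OR of the x (j , l) whose code has bit
-- b equal to d, and V b d k the OR of the W l b d with A k l, row (i , k) is the OR over b of
-- V b (¬ i_b) k.  Each of the three layers costs O(n²) wires: the W of one column come from a binary
-- tree over all 2^B codes, the V from precomputed ORs of all subsets of groups of about B/2 columns
-- (each V then needs one OR per group), and the final ORs share the gates of common prefixes of the
-- codes of i.

module Submission where

open import Defs
open import Data.Nat using (ℕ; zero; suc; _+_; _*_; _^_; _≤_; _<_; _<?_; _≤?_; _/_; _%_; z≤n; s≤s)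
open import Data.Nat.DivMod using (m≡m%n+[m/n]*n; m%n<n; m/n*n≤m; m<n⇒m%n≡m; _mod_)
open import Data.Nat.Properties
  using (≤-trans; ≤-reflexive; ≤-refl; m≤m+n; +-monoʳ-≤; +-monoˡ-≤; +-mono-≤; +-assoc; +-identityʳ; *-assoc; *-monoʳ-≤; *-monoˡ-≤; *-mono-≤; m^n>0; n≤1+n; ≤-antisym; ≤-pred; ≰⇒>; <⇒≤; ^-distribˡ-+-*; m≤m*n; m^n≢0; +-comm; *-distribʳ-+; *-distribˡ-+; *-identityˡ; *-identityʳ; +-suc; module ≤-Reasoning)
open import Data.Nat.Tactic.RingSolver using (solve-∀)
open import Data.Fin as Fin using (Fin; zero; suc; toℕ; fromℕ<; inject≤; combine; quotient; remainder)
open import Data.Fin.Properties using (toℕ-injective; toℕ-fromℕ<; toℕ-inject≤; toℕ<n; remQuot-combine; combine-remQuot; combine-surjective)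
open import Data.Bool using (Bool; true; false; not; _∧_; _∨_; T; _≟_; T?)
open import Data.Bool.Properties using (T-∨; T-∧; ¬-not; not-¬; ∨-identityʳ)
open import Data.Bool.ListAction using (any; or)
open import Data.List using (List; []; _∷_; length; allFin; filter; tabulate)
open import Data.List.Properties using (length-map; length-filter; length-tabulate; map-∘; map-cong)
open import Data.List.Relation.Unary.Any.Properties using (any⁺; any⁻; tabulate⁺; tabulate⁻)
open import Data.List.Membership.Propositional using (_∈_; find; lose)
open import Data.List.Membership.Propositional.Properties using (∈-allFin; ∈-filter⁺; ∈-filter⁻)
open import Data.Fin.Subset using (Subset)
open import Data.Maybe using (Maybe; just; nothing; maybe′)
open import Data.Maybe.Properties using (just-injective)
open import Data.Product using (∃; ∃-syntax; _×_; _,_; proj₁; proj₂)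
import Data.Product as Product
open import Data.Sum using (_⊎_; inj₁; inj₂; [_,_])
import Data.Sum as Sum
open import Data.Unit using (⊤; tt)
open import Data.Empty using (⊥-elim)
open import Data.Vec using (Vec; []; _∷_; lookup)
import Data.Vec as Vec
open import Data.Vec.Properties using (lookup∘tabulate)
open import Function using (_∘_; id; Equivalence)
open import Relation.Nullary using (yes; no; contradiction)
open import Relation.Binary.PropositionalEquality hiding ([_])

T-∨⁻ : ∀ {x y} → T (x ∨ y) → T x ⊎ T y
T-∨⁻ = Equivalence.to T-∨

T-∨⁺ : ∀ {x y} → T x ⊎ T y → T (x ∨ y)
T-∨⁺ = Equivalence.from T-∨

T-ext : ∀ {x y} → (T x → T y) → (T y → T x) → x ≡ y
T-ext {false} {false} _ _ = refl
T-ext {false} {true}  _ g = ⊥-elim (g tt)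
T-ext {true}  {false} f _ = ⊥-elim (f tt)
T-ext {true}  {true}  _ _ = refl

any-∈⁻ : ∀ {A : Set} (v : A → Bool) xs → T (any v xs) → ∃ λ x → x ∈ xs × T (v x)
any-∈⁻ v xs = find ∘ any⁻ v xs

any-∈⁺ : ∀ {A : Set} (v : A → Bool) {xs x} → x ∈ xs → T (v x) → T (any v xs)
any-∈⁺ v x∈xs = any⁺ v ∘ lose x∈xs

-- Binary codes

Bits : ℕ → Set
Bits = Vec Bool

bitToFin : Bool → Fin 2
bitToFin false = zero
bitToFin true  = suc zero

finToBit : Fin 2 → Bool
finToBit zero       = false
finToBit (suc zero) = true

toFin : ∀ {B} → Bits B → Fin (2 ^ B)
toFin []      = zero
toFin (d ∷ u) = combine (bitToFin d) (toFin u)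

ofFin : ∀ {B} → Fin (2 ^ B) → Bits B
ofFin {zero}  y = []
ofFin {suc B} y = finToBit (quotient {2} (2 ^ B) y) ∷ ofFin (remainder {2} (2 ^ B) y)

ofFin-toFin : ∀ {B} (u : Bits B) → ofFin (toFin u) ≡ u
ofFin-toFin []            = refl
ofFin-toFin {suc B} (d ∷ u) =
  trans (cong (λ (c , y) → finToBit c ∷ ofFin y) (remQuot-combine {2} {2 ^ B} (bitToFin d) (toFin u)))
        (cong₂ _∷_ (finToBit-bitToFin d) (ofFin-toFin u))
  where
  finToBit-bitToFin : ∀ d → finToBit (bitToFin d) ≡ d
  finToBit-bitToFin false = refl
  finToBit-bitToFin true  = refl

toFin-ofFin : ∀ {B} (y : Fin (2 ^ B)) → toFin (ofFin {B} y) ≡ y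
toFin-ofFin {zero}  zero = refl
toFin-ofFin {suc B} y =
  trans (cong₂ combine (bitToFin-finToBit (quotient {2} (2 ^ B) y)) (toFin-ofFin {B} (remainder {2} (2 ^ B) y)))
        (combine-remQuot {2} (2 ^ B) y)
  where
  bitToFin-finToBit : ∀ c → bitToFin (finToBit c) ≡ c
  bitToFin-finToBit zero       = refl
  bitToFin-finToBit (suc zero) = refl

restrict : ∀ {n N} → Fin N → Maybe (Fin n)
restrict {n} y with toℕ y <? n
... | yes y<n = just (fromℕ< y<n)
... | no  _   = nothing

restrict-inject≤ : ∀ {n N} (j : Fin n) (n≤N : n ≤ N) → restrict (inject≤ j n≤N) ≡ just j
restrict-inject≤ {n} j n≤N with toℕ (inject≤ j n≤N) <? n
... | yes y<n = cong just (toℕ-injective (trans (toℕ-fromℕ< y<n) (toℕ-inject≤ j n≤N)))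
... | no  y≮n = contradiction (subst (_< n) (sym (toℕ-inject≤ j n≤N)) (toℕ<n j)) y≮n

restrict-just : ∀ {n N} (y : Fin N) {j : Fin n} → restrict y ≡ just j → toℕ y ≡ toℕ j
restrict-just {n} y eq with toℕ y <? n
restrict-just y refl | yes y<n = sym (toℕ-fromℕ< y<n)

module BinaryCode {n B : ℕ} (n≤2^B : n ≤ 2 ^ B) where

  encode : Fin n → Bits B
  encode j = ofFin (inject≤ j n≤2^B)

  decode : Bits B → Maybe (Fin n)
  decode u = restrict (toFin u)

  decode-encode : ∀ j → decode (encode j) ≡ just j
  decode-encode j rewrite toFin-ofFin {B} (inject≤ j n≤2^B) = restrict-inject≤ j n≤2^B

  decode-just : ∀ u {j} → decode u ≡ just j → u ≡ encode j
  decode-just u {j} eq = trans (sym (ofFin-toFin u))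
    (cong ofFin (toℕ-injective (trans (restrict-just (toFin u) eq) (sym (toℕ-inject≤ j n≤2^B)))))

  encode-injective : ∀ {i j} → encode i ≡ encode j → i ≡ j
  encode-injective {i} {j} eq = just-injective (trans (sym (decode-encode i)) (trans (cong decode eq) (decode-encode j)))

differingBit : ∀ {B} (u w : Bits B) → u ≢ w → ∃ λ b → lookup w b ≡ not (lookup u b)
differingBit []      []      u≢w = contradiction refl u≢w
differingBit (x ∷ u) (y ∷ w) u≢w with x ≟ y
... | no  x≢y  = zero , ¬-not (x≢y ∘ sym)
... | yes refl = Product.map suc id (differingBit u w (u≢w ∘ cong (x ∷_)))

Ibar⁻ : ∀ {n} {i j : Fin n} → T (Ibar n i j) → i ≢ j
Ibar⁻ {i = i} {j} t with i Fin.≟ j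
... | no i≢j = i≢j

Ibar⁺ : ∀ {n} {i j : Fin n} → i ≢ j → T (Ibar n i j)
Ibar⁺ {i = i} {j} i≢j with i Fin.≟ j
... | yes i≡j = contradiction i≡j i≢j
... | no  _   = tt

⊗-entry : ∀ {n} (M N : Matrix n n) r j l →
          (M ⊗ N) r (combine j l) ≡ M (quotient {n} n r) j ∧ N (remainder {n} n r) l
⊗-entry {n} M N r j l = cong (λ (j′ , l′) → M (quotient {n} n r) j′ ∧ N (remainder {n} n r) l′) (remQuot-combine j l)

rowOr⁻ : ∀ {r m} (M : Matrix r m) i x → T (rowOr M i x) → ∃ λ j → T (M i j) × T (x j)
rowOr⁻ {m = m} M i x t with any-∈⁻ _ (allFin m) t
... | j , _ , t′ = j , Equivalence.to T-∧ t′

rowOr⁺ : ∀ {r m} (M : Matrix r m) i x j → T (M i j) → T (x j) → T (rowOr M i x)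
rowOr⁺ M i x j Mij xj = any-∈⁺ _ (∈-allFin j) (Equivalence.from T-∧ (Mij , xj))

rowOr-Ibar⊗⁻ : ∀ {n} (A : Matrix n n) r x → T (rowOr (Ibar n ⊗ A) r x) →
               ∃ λ j → ∃ λ l → quotient {n} n r ≢ j × T (A (remainder {n} n r) l) × T (x (combine j l))
rowOr-Ibar⊗⁻ {n} A r x t with rowOr⁻ (Ibar n ⊗ A) r x t
... | c , Mrc , xc with combine-surjective {n} {n} c
...   | j , l , refl with Equivalence.to T-∧ (subst T (⊗-entry (Ibar n) A r j l) Mrc)
...     | Ibar-ij , Akl = j , l , Ibar⁻ Ibar-ij , Akl , xc

rowOr-Ibar⊗⁺ : ∀ {n} (A : Matrix n n) r x j l → quotient {n} n r ≢ j → T (A (remainder {n} n r) l) → T (x (combine j l)) →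
               T (rowOr (Ibar n ⊗ A) r x)
rowOr-Ibar⊗⁺ {n} A r x j l i≢j Akl xjl =
  rowOr⁺ (Ibar n ⊗ A) r x (combine j l) (subst T (sym (⊗-entry (Ibar n) A r j l)) (Equivalence.from T-∧ (Ibar⁺ i≢j , Akl))) xjl

-- ORs over binary words

Selector : ℕ → Set
Selector B = ⊤ ⊎ (Fin B × Bool)

-- bitSums B v (inj₁ tt) is the OR of v over all words, bitSums B v (inj₂ (b , d)) the OR over the
-- words whose bit b is d; the recursion splits the words by their first bit.
bitSums : (B : ℕ) → (Bits B → Bool) → Selector B → Bool
bitSums zero    v (inj₁ tt)           = v []
bitSums (suc B) v (inj₁ tt)           = bitSums B (v ∘ (false ∷_)) (inj₁ tt) ∨ bitSums B (v ∘ (true ∷_)) (inj₁ tt)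
bitSums (suc B) v (inj₂ (zero , d))   = bitSums B (v ∘ (d ∷_)) (inj₁ tt)
bitSums (suc B) v (inj₂ (suc b , d))  =
  bitSums B (v ∘ (false ∷_)) (inj₂ (b , d)) ∨ bitSums B (v ∘ (true ∷_)) (inj₂ (b , d))

bitSums-all⁻ : ∀ B v → T (bitSums B v (inj₁ tt)) → ∃ λ u → T (v u)
bitSums-all⁻ zero    v t = [] , t
bitSums-all⁻ (suc B) v t with T-∨⁻ t
... | inj₁ t₀ = Product.map (false ∷_) id (bitSums-all⁻ B _ t₀)
... | inj₂ t₁ = Product.map (true ∷_) id (bitSums-all⁻ B _ t₁)

bitSums-all⁺ : ∀ B v u → T (v u) → T (bitSums B v (inj₁ tt))
bitSums-all⁺ zero    v []          t = t
bitSums-all⁺ (suc B) v (false ∷ u) t = T-∨⁺ (inj₁ (bitSums-all⁺ B _ u t))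
bitSums-all⁺ (suc B) v (true ∷ u)  t = T-∨⁺ (inj₂ (bitSums-all⁺ B _ u t))

bitSums-bit⁻ : ∀ B v b d → T (bitSums B v (inj₂ (b , d))) → ∃ λ u → lookup u b ≡ d × T (v u)
bitSums-bit⁻ (suc B) v zero    d t = Product.map (d ∷_) (refl ,_) (bitSums-all⁻ B _ t)
bitSums-bit⁻ (suc B) v (suc b) d t with T-∨⁻ t
... | inj₁ t₀ = Product.map (false ∷_) id (bitSums-bit⁻ B _ b d t₀)
... | inj₂ t₁ = Product.map (true ∷_) id (bitSums-bit⁻ B _ b d t₁)

bitSums-bit⁺ : ∀ B v b u → T (v u) → T (bitSums B v (inj₂ (b , lookup u b)))
bitSums-bit⁺ (suc B) v zero    (d ∷ u)     t = bitSums-all⁺ B _ u t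
bitSums-bit⁺ (suc B) v (suc b) (false ∷ u) t = T-∨⁺ (inj₁ (bitSums-bit⁺ B _ b u t))
bitSums-bit⁺ (suc B) v (suc b) (true ∷ u)  t = T-∨⁺ (inj₂ (bitSums-bit⁺ B _ b u t))

pushBit : ∀ {B} → (Selector (suc B) → Bool) → Bool → Selector B → Bool
pushBit v c (inj₁ tt)      = v (inj₁ tt) ∨ v (inj₂ (zero , not c))
pushBit v c (inj₂ (b , d)) = v (inj₂ (suc b , d))

-- mismatch B v w is v (inj₁ tt) ∨ ⋁_b v (inj₂ (b , not (lookup w b))); the first disjunct
-- accumulates the terms of the bits already read, so that words with a common prefix share gates.
mismatch : (B : ℕ) → (Selector B → Bool) → Bits B → Bool
mismatch zero    v []      = v (inj₁ tt)
mismatch (suc B) v (c ∷ w) = mismatch B (pushBit v c) w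

mismatch-cong : ∀ B {v v′ : Selector B → Bool} → (∀ σ → v σ ≡ v′ σ) → ∀ w → mismatch B v w ≡ mismatch B v′ w
mismatch-cong zero    v≗v′ []      = v≗v′ (inj₁ tt)
mismatch-cong (suc B) v≗v′ (c ∷ w) = mismatch-cong B pushed w
  where
  pushed : ∀ σ → pushBit _ c σ ≡ pushBit _ c σ
  pushed (inj₁ tt)      = cong₂ _∨_ (v≗v′ (inj₁ tt)) (v≗v′ _)
  pushed (inj₂ (b , d)) = v≗v′ _

mismatch⁻ : ∀ B v w → T (mismatch B v w) → T (v (inj₁ tt)) ⊎ ∃ λ b → T (v (inj₂ (b , not (lookup w b))))
mismatch⁻ zero    v []      t = inj₁ t
mismatch⁻ (suc B) v (c ∷ w) t with mismatch⁻ B (pushBit v c) w t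
... | inj₂ (b , t′) = inj₂ (suc b , t′)
... | inj₁ t′       = Sum.map id (zero ,_) (T-∨⁻ t′)

mismatch⁺ : ∀ B v w → T (v (inj₁ tt)) ⊎ ∃ (λ b → T (v (inj₂ (b , not (lookup w b))))) → T (mismatch B v w)
mismatch⁺ zero    v []      (inj₁ t)             = t
mismatch⁺ (suc B) v (c ∷ w) (inj₁ t)             = mismatch⁺ B (pushBit v c) w (inj₁ (T-∨⁺ (inj₁ t)))
mismatch⁺ (suc B) v (c ∷ w) (inj₂ (zero , t))    = mismatch⁺ B (pushBit v c) w (inj₁ (T-∨⁺ (inj₂ t)))
mismatch⁺ (suc B) v (c ∷ w) (inj₂ (suc b , t))   = mismatch⁺ B (pushBit v c) w (inj₂ (b , t))

members : ∀ {s} → Subset s → List (Fin s)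
members S = filter (λ p → T? (lookup S p)) (allFin _)

members-length : ∀ {s} (S : Subset s) → length (members S) ≤ s
members-length {s} S = ≤-trans (length-filter (λ p → T? (lookup S p)) (allFin s)) (≤-reflexive (length-tabulate id))

members⁺ : ∀ {s} (S : Subset s) {p} → T (lookup S p) → p ∈ members S
members⁺ S {p} = ∈-filter⁺ (λ p → T? (lookup S p)) (∈-allFin p)

members⁻ : ∀ {s} (S : Subset s) {p} → p ∈ members S → T (lookup S p)
members⁻ {s} S = proj₂ ∘ ∈-filter⁻ (λ p → T? (lookup S p)) {xs = allFin s}

-- Gadgets

bitSumsCost : ℕ → ℕ
bitSumsCost zero    = 0
bitSumsCost (suc B) = (bitSumsCost B + bitSumsCost B) + (2 + suc B * 4)

mismatchCost : ℕ → ℕ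
mismatchCost zero    = 0
mismatchCost (suc B) = 4 + (mismatchCost B + mismatchCost B)

module Gadgets (m : ℕ) where

  record Extension {g} (c : Circuit m g) {I O : Set} (input : I → Node m g)
                   (K : ℕ) (f : (I → Bool) → O → Bool) : Set where
    field
      gates′      : ℕ
      circuit′    : Circuit m gates′
      lift        : Node m g → Node m gates′
      lift-eval   : ∀ x v → evalNode circuit′ x (lift v) ≡ evalNode c x v
      output      : O → Node m gates′
      output-eval : ∀ x {val} → (∀ i → evalNode c x (input i) ≡ val i) →
                    ∀ o → evalNode circuit′ x (output o) ≡ f val o
      size-≤      : size circuit′ ≤ size c + K

  open Extension

  -- A gadget adds at most K wires to any circuit, computing f of the values at the given nodes.
  Gadget : (I O : Set) → ℕ → ((I → Bool) → O → Bool) → Set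
  Gadget I O K f = ∀ {g} (c : Circuit m g) (input : I → Node m g) → Extension c input K f

  unchanged : ∀ {g} {c : Circuit m g} {I O f} {input : I → Node m g}
              (output : O → Node m g) → (∀ x {val} → (∀ i → evalNode c x (input i) ≡ val i) →
              ∀ o → evalNode c x (output o) ≡ f val o) → Extension c input 0 f
  unchanged {c = c} output output-eval = record
    { gates′ = _ ; circuit′ = c ; lift = id ; lift-eval = λ _ _ → refl
    ; output = output ; output-eval = output-eval ; size-≤ = m≤m+n (size c) 0 }

  orGate : ∀ {I} (L : List I) → Gadget I ⊤ (length L) (λ v _ → any v L)
  orGate L c input = record
    { gates′ = _ ; circuit′ = c ▷ Data.List.map input L ; lift = Sum.map₂ suc ; lift-eval = lift-suc
    ; output = λ _ → inj₂ zero
    ; output-eval = λ x val≗ _ → cong or (trans (sym (map-∘ L)) (map-cong val≗ L))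
    ; size-≤ = ≤-reflexive (cong (size c +_) (length-map input L)) }
    where
    lift-suc : ∀ x v → evalNode (c ▷ _) x (Sum.map₂ suc v) ≡ evalNode c x v
    lift-suc x (inj₁ j) = refl
    lift-suc x (inj₂ i) = refl

  idGadget : ∀ {I} → Gadget I I 0 (λ v → v)
  idGadget c input = unchanged input (λ x val≗ → val≗)

  mapOutputs : ∀ {I O P K f} (r : P → O) → Gadget I O K f → Gadget I P K (λ v → f v ∘ r)
  mapOutputs r G c input = let E = G c input in record
    { gates′ = _ ; circuit′ = circuit′ E ; lift = lift E ; lift-eval = lift-eval E
    ; output = output E ∘ r ; output-eval = λ x val≗ → output-eval E x val≗ ∘ r ; size-≤ = size-≤ E }

  mapInputs : ∀ {I J O K f} (r : I → J) → Gadget I O K f → Gadget J O K (λ v → f (v ∘ r))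
  mapInputs r G c input = let E = G c (input ∘ r) in record
    { gates′ = _ ; circuit′ = circuit′ E ; lift = lift E ; lift-eval = lift-eval E
    ; output = output E ; output-eval = λ x val≗ → output-eval E x (val≗ ∘ r) ; size-≤ = size-≤ E }

  respecify : ∀ {I O K f f′} → (∀ v o → f v o ≡ f′ v o) → Gadget I O K f → Gadget I O K f′
  respecify f≗f′ G c input = let E = G c input in record
    { gates′ = _ ; circuit′ = circuit′ E ; lift = lift E ; lift-eval = lift-eval E
    ; output = output E ; output-eval = λ x {val} val≗ o → trans (output-eval E x val≗ o) (f≗f′ val o)
    ; size-≤ = size-≤ E }

  weaken : ∀ {I O K K′ f} → K ≤ K′ → Gadget I O K f → Gadget I O K′ f
  weaken K≤K′ G c input = let E = G c input in record
    { gates′ = _ ; circuit′ = circuit′ E ; lift = lift E ; lift-eval = lift-eval E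
    ; output = output E ; output-eval = output-eval E
    ; size-≤ = ≤-trans (size-≤ E) (+-monoʳ-≤ (size c) K≤K′) }

  infixr 4 _⨾_
  infixr 5 _∥_

  _⨾_ : ∀ {I O P K₁ K₂ f h} → Gadget I O K₁ f → Gadget O P K₂ h → Gadget I P (K₁ + K₂) (λ v → h (f v))
  _⨾_ {K₁ = K₁} {K₂} {f} {h} G H c input = record
    { gates′ = _ ; circuit′ = circuit′ F ; lift = lift F ∘ lift E
    ; lift-eval = λ x v → trans (lift-eval F x (lift E v)) (lift-eval E x v)
    ; output = output F
    ; output-eval = λ x val≗ → output-eval F x (output-eval E x val≗)
    ; size-≤ = ≤-trans (size-≤ F) (≤-trans (+-monoˡ-≤ K₂ (size-≤ E)) (≤-reflexive (+-assoc (size c) K₁ K₂))) }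
    where
    E : Extension c input K₁ f
    E = G c input
    F : Extension (circuit′ E) (output E) K₂ h
    F = H (circuit′ E) (output E)

  _∥_ : ∀ {I O₁ O₂ K₁ K₂ f₁ f₂} → Gadget I O₁ K₁ f₁ → Gadget I O₂ K₂ f₂ →
        Gadget I (O₁ ⊎ O₂) (K₁ + K₂) (λ v → [ f₁ v , f₂ v ])
  _∥_ {K₁ = K₁} {K₂} {f₁} {f₂} G H c input = record
    { gates′ = _ ; circuit′ = circuit′ F ; lift = lift F ∘ lift E
    ; lift-eval = λ x v → trans (lift-eval F x (lift E v)) (lift-eval E x v)
    ; output = [ lift F ∘ output E , output F ]
    ; output-eval = λ where
        x val≗ (inj₁ o) → trans (lift-eval F x (output E o)) (output-eval E x val≗ o)
        x val≗ (inj₂ o) → output-eval F x (λ i → trans (lift-eval E x (input i)) (val≗ i)) o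
    ; size-≤ = ≤-trans (size-≤ F) (≤-trans (+-monoˡ-≤ K₂ (size-≤ E)) (≤-reflexive (+-assoc (size c) K₁ K₂))) }
    where
    E : Extension c input K₁ f₁
    E = G c input
    F : Extension (circuit′ E) (lift E ∘ input) K₂ f₂
    F = H (circuit′ E) (lift E ∘ input)

  withFalse : ∀ {I} → Gadget I (I ⊎ ⊤) 0 (λ v → [ v , (λ _ → false) ])
  withFalse = idGadget ∥ orGate []

  forEachFin : ∀ {I O K} t {f : Fin t → (I → Bool) → O → Bool} → (∀ u → Gadget I O K (f u)) →
               Gadget I (Fin t × O) (t * K) (λ v (u , o) → f u v o)
  forEachFin zero    G c input = unchanged (λ { (() , _) }) (λ { x val≗ (() , _) })
  forEachFin (suc t) {f} G = respecify spec≡ (mapOutputs split (G zero ∥ forEachFin t (G ∘ suc)))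
    where
    split : ∀ {O} → Fin (suc t) × O → O ⊎ (Fin t × O)
    split (zero  , o) = inj₁ o
    split (suc u , o) = inj₂ (u , o)
    spec≡ : ∀ v uo → [ f zero v , (λ (u , o) → f (suc u) v o) ] (split uo) ≡ f (proj₁ uo) v (proj₂ uo)
    spec≡ v (zero  , o) = refl
    spec≡ v (suc u , o) = refl

  forEachBool : ∀ {I O K} {f : Bool → (I → Bool) → O → Bool} → (∀ d → Gadget I O K (f d)) →
                Gadget I (Bool × O) (K + K) (λ v (d , o) → f d v o)
  forEachBool {f = f} G = respecify spec≡ (mapOutputs split (G false ∥ G true))
    where
    split : ∀ {O} → Bool × O → O ⊎ O
    split (false , o) = inj₁ o
    split (true  , o) = inj₂ o
    spec≡ : ∀ v dx → [ f false v , f true v ] (split dx) ≡ f (proj₁ dx) v (proj₂ dx)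
    spec≡ v (false , o) = refl
    spec≡ v (true  , o) = refl

  forEachBits : ∀ {I O K} s {f : Bits s → (I → Bool) → O → Bool} → (∀ u → Gadget I O K (f u)) →
                Gadget I (Bits s × O) (2 ^ s * K) (λ v (u , o) → f u v o)
  forEachBits {K = K} zero G =
    weaken (m≤m+n K 0) (respecify (λ { v ([] , o) → refl }) (mapOutputs proj₂ (G [])))
  forEachBits {K = K} (suc s) G =
    weaken (≤-reflexive (trans (double (2 ^ s * K)) (sym (*-assoc 2 (2 ^ s) K))))
      (respecify (λ { v (d ∷ u , o) → refl }) (mapOutputs split (forEachBool (λ d → forEachBits s (G ∘ (d ∷_))))))
    where
    split : ∀ {O} → Bits (suc s) × O → Bool × (Bits s × O)
    split (d ∷ u , o) = d , (u , o)
    double : ∀ a → a + a ≡ 2 * a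
    double a = cong (a +_) (sym (+-identityʳ a))

  bitSumsGadget : ∀ B → Gadget (Bits B) (Selector B) (bitSumsCost B) (bitSums B)
  bitSumsGadget zero    = respecify (λ { v (inj₁ tt) → refl ; v (inj₂ (() , _)) }) (mapOutputs (λ _ → []) idGadget)
  bitSumsGadget (suc B) = respecify spec≡ (halves ⨾ mapOutputs regroup (totals ∥ bitwise))
    where
    halves : Gadget (Bits (suc B)) (Selector B ⊎ Selector B) (bitSumsCost B + bitSumsCost B)
                    (λ v → [ bitSums B (v ∘ (false ∷_)) , bitSums B (v ∘ (true ∷_)) ])
    halves = mapInputs (false ∷_) (bitSumsGadget B) ∥ mapInputs (true ∷_) (bitSumsGadget B)
    totals : Gadget (Selector B ⊎ Selector B) ⊤ 2 (λ v _ → any v (inj₁ (inj₁ tt) ∷ inj₂ (inj₁ tt) ∷ []))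
    totals = orGate (inj₁ (inj₁ tt) ∷ inj₂ (inj₁ tt) ∷ [])
    half : Bool → Selector B → Selector B ⊎ Selector B
    half false = inj₁
    half true  = inj₂
    children : Fin (suc B) → Bool → List (Selector B ⊎ Selector B)
    children zero    d = half d (inj₁ tt) ∷ []
    children (suc b) d = inj₁ (inj₂ (b , d)) ∷ inj₂ (inj₂ (b , d)) ∷ []
    children≤2 : ∀ b d → length (children b d) ≤ 2
    children≤2 zero    d = s≤s z≤n
    children≤2 (suc b) d = ≤-refl
    bitwise : Gadget (Selector B ⊎ Selector B) (Fin (suc B) × (Bool × ⊤)) (suc B * 4) (λ v (b , d , _) → any v (children b d))
    bitwise = forEachFin (suc B) (λ b → forEachBool (λ d → weaken (children≤2 b d) (orGate (children b d))))
    regroup : Selector (suc B) → ⊤ ⊎ (Fin (suc B) × (Bool × ⊤))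
    regroup (inj₁ tt)      = inj₁ tt
    regroup (inj₂ (b , d)) = inj₂ (b , (d , tt))
    spec≡ : ∀ v σ → _ ≡ bitSums (suc B) v σ
    spec≡ v (inj₁ tt)             = cong (bitSums B (v ∘ (false ∷_)) (inj₁ tt) ∨_) (∨-identityʳ _)
    spec≡ v (inj₂ (zero , false)) = ∨-identityʳ _
    spec≡ v (inj₂ (zero , true))  = ∨-identityʳ _
    spec≡ v (inj₂ (suc b , d))    = cong (bitSums B (v ∘ (false ∷_)) (inj₂ (b , d)) ∨_) (∨-identityʳ _)

  mismatchGadget : ∀ B → Gadget (Selector B) (Bits B) (mismatchCost B) (mismatch B)
  mismatchGadget zero    = respecify (λ { v [] → refl }) (mapOutputs (λ _ → inj₁ tt) idGadget)
  mismatchGadget (suc B) =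
    respecify spec≡ (pushGates ⨾ mapOutputs uncons (forEachBool (λ c → mapInputs (pushed c) (mismatchGadget B))))
    where
    pushGates : Gadget (Selector (suc B)) ((Bool × ⊤) ⊎ Selector (suc B)) 4
                       (λ v → [ (λ (c , _) → any v (inj₁ tt ∷ inj₂ (zero , not c) ∷ [])) , v ])
    pushGates = forEachBool (λ c → orGate (inj₁ tt ∷ inj₂ (zero , not c) ∷ [])) ∥ idGadget
    pushed : Bool → Selector B → (Bool × ⊤) ⊎ Selector (suc B)
    pushed c (inj₁ tt)      = inj₁ (c , tt)
    pushed c (inj₂ (b , d)) = inj₂ (inj₂ (suc b , d))
    uncons : Bits (suc B) → Bool × Bits B
    uncons (c ∷ w) = c , w
    spec≡ : ∀ v w → _ ≡ mismatch (suc B) v w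
    spec≡ v (c ∷ w) = mismatch-cong B pushed≗ w
      where
      pushed≗ : ∀ σ → _ ≡ pushBit v c σ
      pushed≗ (inj₁ tt)      = cong (v (inj₁ tt) ∨_) (∨-identityʳ _)
      pushed≗ (inj₂ (b , d)) = refl

  subsetSums : ∀ s → Gadget (Fin s) (Subset s × ⊤) (2 ^ s * s) (λ v (S , _) → any v (members S))
  subsetSums s = forEachBits s (λ S → weaken (members-length S) (orGate (members S)))

-- Cost bounds

n<2^n : ∀ n → n < 2 ^ n
n<2^n zero    = s≤s z≤n
n<2^n (suc n) = begin-strict
  suc n           <⟨ s≤s (n<2^n n) ⟩
  1 + 2 ^ n       ≤⟨ +-monoˡ-≤ (2 ^ n) (m^n>0 2 n) ⟩
  2 ^ n + 2 ^ n   ≡⟨ cong (2 ^ n +_) (sym (+-identityʳ _)) ⟩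
  2 ^ suc n       ∎
  where open ≤-Reasoning

bitSumsCost-exact : ∀ B → bitSumsCost B + (4 * B + 10) ≡ 10 * 2 ^ B
bitSumsCost-exact zero    = refl
bitSumsCost-exact (suc B) = begin
  bitSumsCost (suc B) + (4 * suc B + 10) ≡⟨ regroup (bitSumsCost B) B ⟩
  2 * (bitSumsCost B + (4 * B + 10))     ≡⟨ cong (2 *_) (bitSumsCost-exact B) ⟩
  2 * (10 * 2 ^ B)                       ≡⟨ swap (2 ^ B) ⟩
  10 * 2 ^ suc B                         ∎
  where
  open ≡-Reasoning
  regroup : ∀ c B → (c + c) + (2 + suc B * 4) + (4 * suc B + 10) ≡ 2 * (c + (4 * B + 10))
  regroup = solve-∀
  swap : ∀ y → 2 * (10 * y) ≡ 10 * (2 * y)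
  swap = solve-∀

mismatchCost-exact : ∀ B → mismatchCost B + 4 ≡ 4 * 2 ^ B
mismatchCost-exact zero    = refl
mismatchCost-exact (suc B) = begin
  mismatchCost (suc B) + 4  ≡⟨ regroup (mismatchCost B) ⟩
  2 * (mismatchCost B + 4)  ≡⟨ cong (2 *_) (mismatchCost-exact B) ⟩
  2 * (4 * 2 ^ B)           ≡⟨ swap (2 ^ B) ⟩
  4 * 2 ^ suc B             ∎
  where
  open ≡-Reasoning
  regroup : ∀ c → 4 + (c + c) + 4 ≡ 2 * (c + 4)
  regroup = solve-∀
  swap : ∀ y → 2 * (4 * y) ≡ 4 * (2 * y)
  swap = solve-∀

2^-double-suc : ∀ h → 2 ^ (suc h + suc h) ≡ 4 * 2 ^ (h + h)
2^-double-suc h = trans (cong (λ e → 2 ^ suc e) (+-suc h h)) (sym (*-assoc 2 2 (2 ^ (h + h))))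

powerOfFour-between : ∀ n′ → ∃ λ h → suc n′ ≤ 2 ^ (h + h) × 2 ^ (h + h) ≤ 4 * suc n′
powerOfFour-between zero = 0 , ≤-refl , s≤s z≤n
powerOfFour-between (suc n′) with powerOfFour-between n′
... | h , n≤X , X≤4n with suc (suc n′) ≤? 2 ^ (h + h)
...   | yes n+1≤X = h , n+1≤X , ≤-trans X≤4n (*-monoʳ-≤ 4 (n≤1+n (suc n′)))
...   | no  n+1≰X = suc h , subst (suc (suc n′) ≤_) (sym X′≡4n) n+1≤4n
                          , subst (_≤ 4 * suc (suc n′)) (sym X′≡4n) (*-monoʳ-≤ 4 (n≤1+n (suc n′)))
  where
  X′≡4n : 2 ^ (suc h + suc h) ≡ 4 * suc n′
  X′≡4n = trans (2^-double-suc h) (cong (4 *_) (≤-antisym (≤-pred (≰⇒> n+1≰X)) n≤X))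
  n+1≤4n : suc (suc n′) ≤ 4 * suc n′
  n+1≤4n = subst (suc (suc n′) ≤_) (sym (split n′)) (m≤m+n (2 + n′) (2 + 3 * n′))
    where
    split : ∀ k → 4 * suc k ≡ (2 + k) + (2 + 3 * k)
    split = solve-∀

module Parameters (n′ h : ℕ) (n≤X : suc n′ ≤ 2 ^ (h + h)) (X≤4n : 2 ^ (h + h) ≤ 4 * suc n′) where

  open ≤-Reasoning

  n B s q : ℕ
  n = suc n′
  B = h + h
  s = suc h
  q = n / s + 1

  X≡Y*Y : 2 ^ B ≡ 2 ^ h * 2 ^ h
  X≡Y*Y = ^-distribˡ-+-* 2 h h

  s≤4n : s ≤ 4 * n
  s≤4n = begin
    s             ≤⟨ n<2^n h ⟩
    2 ^ h         ≤⟨ m≤m*n (2 ^ h) (2 ^ h) {{m^n≢0 2 h}} ⟩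
    2 ^ h * 2 ^ h ≡⟨ X≡Y*Y ⟨
    2 ^ B         ≤⟨ X≤4n ⟩
    4 * n         ∎

  n≤q*s : n ≤ q * s
  n≤q*s = begin
    n               ≡⟨ m≡m%n+[m/n]*n n s ⟩
    n % s + n / s * s ≤⟨ +-monoˡ-≤ (n / s * s) (<⇒≤ (m%n<n n s)) ⟩
    s + n / s * s   ≡⟨ +-comm s (n / s * s) ⟩
    n / s * s + s   ≡⟨ cong (n / s * s +_) (*-identityˡ s) ⟨
    n / s * s + 1 * s ≡⟨ *-distribʳ-+ s (n / s) 1 ⟨
    q * s           ∎

  q*s≤5n : q * s ≤ 5 * n
  q*s≤5n = begin
    q * s             ≡⟨ *-distribʳ-+ s (n / s) 1 ⟩
    n / s * s + 1 * s ≤⟨ +-mono-≤ (m/n*n≤m n s) (≤-trans (≤-reflexive (*-identityˡ s)) s≤4n) ⟩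
    n + 4 * n         ∎

  B≤4n : B ≤ 4 * n
  B≤4n = ≤-trans (<⇒≤ (n<2^n B)) X≤4n

  B*q≤6n : B * q ≤ 6 * n
  B*q≤6n = begin
    B * q                   ≡⟨ *-distribˡ-+ B (n / s) 1 ⟩
    B * (n / s) + B * 1     ≤⟨ +-mono-≤ (*-monoˡ-≤ (n / s) B≤2s) (≤-trans (≤-reflexive (*-identityʳ B)) B≤4n) ⟩
    2 * s * (n / s) + 4 * n ≡⟨ cong (_+ 4 * n) (regroup s (n / s)) ⟩
    2 * (n / s * s) + 4 * n ≤⟨ +-monoˡ-≤ (4 * n) (*-monoʳ-≤ 2 (m/n*n≤m n s)) ⟩
    2 * n + 4 * n           ≡⟨ collect n ⟩
    6 * n                   ∎
    where
    B≤2s : B ≤ 2 * s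
    B≤2s = ≤-trans (+-mono-≤ (n≤1+n h) (n≤1+n h)) (≤-reflexive (cong (s +_) (sym (+-identityʳ s))))
    regroup : ∀ s a → 2 * s * a ≡ 2 * (a * s)
    regroup = solve-∀
    collect : ∀ n → 2 * n + 4 * n ≡ 6 * n
    collect = solve-∀

  B*2^s≤16n : B * 2 ^ s ≤ 16 * n
  B*2^s≤16n = begin
    B * (2 * 2 ^ h)             ≤⟨ *-monoˡ-≤ (2 * 2 ^ h) (+-mono-≤ h≤Y h≤Y) ⟩
    (2 ^ h + 2 ^ h) * (2 * 2 ^ h) ≡⟨ regroup (2 ^ h) ⟩
    4 * (2 ^ h * 2 ^ h)         ≡⟨ cong (4 *_) X≡Y*Y ⟨
    4 * 2 ^ B                   ≤⟨ *-monoʳ-≤ 4 X≤4n ⟩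
    4 * (4 * n)                 ≡⟨ *-assoc 4 4 n ⟨
    16 * n                      ∎
    where
    h≤Y : h ≤ 2 ^ h
    h≤Y = <⇒≤ (n<2^n h)
    regroup : ∀ y → (y + y) * (2 * y) ≡ 4 * (y * y)
    regroup = solve-∀

  bitSumsStage-cost : n * bitSumsCost B ≤ 40 * (n * n)
  bitSumsStage-cost = begin
    n * bitSumsCost B   ≤⟨ *-monoʳ-≤ n (≤-trans (m≤m+n _ _) (≤-reflexive (bitSumsCost-exact B))) ⟩
    n * (10 * 2 ^ B)    ≤⟨ *-monoʳ-≤ n (*-monoʳ-≤ 10 X≤4n) ⟩
    n * (10 * (4 * n))  ≡⟨ regroup n ⟩
    40 * (n * n)        ∎
    where
    regroup : ∀ n → n * (10 * (4 * n)) ≡ 40 * (n * n)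
    regroup = solve-∀

  mismatchStage-cost : n * mismatchCost B ≤ 16 * (n * n)
  mismatchStage-cost = begin
    n * mismatchCost B  ≤⟨ *-monoʳ-≤ n (≤-trans (m≤m+n _ _) (≤-reflexive (mismatchCost-exact B))) ⟩
    n * (4 * 2 ^ B)     ≤⟨ *-monoʳ-≤ n (*-monoʳ-≤ 4 X≤4n) ⟩
    n * (4 * (4 * n))   ≡⟨ regroup n ⟩
    16 * (n * n)        ∎
    where
    regroup : ∀ n → n * (4 * (4 * n)) ≡ 16 * (n * n)
    regroup = solve-∀

  rowSumsStage-cost : B * (q * (2 ^ s * s) + q * (2 ^ s * s)) + B * (n * q + n * q) ≤ 172 * (n * n)
  rowSumsStage-cost = begin
    B * (q * (2 ^ s * s) + q * (2 ^ s * s)) + B * (n * q + n * q)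
      ≡⟨ regroup B q (2 ^ s) s n ⟩
    2 * ((B * 2 ^ s) * (q * s)) + 2 * (n * (B * q))
      ≤⟨ +-mono-≤ (*-monoʳ-≤ 2 (*-mono-≤ B*2^s≤16n q*s≤5n)) (*-monoʳ-≤ 2 (*-monoʳ-≤ n B*q≤6n)) ⟩
    2 * ((16 * n) * (5 * n)) + 2 * (n * (6 * n))
      ≡⟨ collect n ⟩
    172 * (n * n) ∎
    where
    regroup : ∀ B q P s n → B * (q * (P * s) + q * (P * s)) + B * (n * q + n * q)
                            ≡ 2 * ((B * P) * (q * s)) + 2 * (n * (B * q))
    regroup = solve-∀
    collect : ∀ n → 2 * ((16 * n) * (5 * n)) + 2 * (n * (6 * n)) ≡ 172 * (n * n)
    collect = solve-∀

-- The circuit for Ī ⊗ A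

module Construction (n′ h : ℕ) (n≤X : suc n′ ≤ 2 ^ (h + h)) (X≤4n : 2 ^ (h + h) ≤ 4 * suc n′)
                    (A : Matrix (suc n′) (suc n′)) where

  open Parameters n′ h n≤X X≤4n
  open BinaryCode {n} {B} n≤X
  open Gadgets (n * n)
  open Extension

  columnInput : Fin n → Bits B → Fin (n * n) ⊎ ⊤
  columnInput l u = maybe′ (λ j → inj₁ (combine j l)) (inj₂ tt) (decode u)

  columnSums : (Fin (n * n) → Bool) → Fin n × Selector B → Bool
  columnSums x (l , σ) = bitSums B ([ x , (λ _ → false) ] ∘ columnInput l) σ

  columnSums⁻ : ∀ x l b d → T (columnSums x (l , inj₂ (b , d))) →
                ∃ λ j → lookup (encode j) b ≡ d × T (x (combine j l))
  columnSums⁻ x l b d t with bitSums-bit⁻ B _ b d t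
  ... | u , u[b]≡d , t′ with decode u in eq
  ...   | just j = j , subst (λ w → lookup w b ≡ d) (decode-just u eq) u[b]≡d , t′

  columnSums⁺ : ∀ x l j → T (x (combine j l)) → ∀ b → T (columnSums x (l , inj₂ (b , lookup (encode j) b)))
  columnSums⁺ x l j t b =
    bitSums-bit⁺ B _ b (encode j) (subst (T ∘ [ x , (λ _ → false) ] ∘ maybe′ _ _) (sym (decode-encode j)) t)

  bitSumsStage : Gadget (Fin (n * n)) (Fin n × Selector B) (0 + n * bitSumsCost B) columnSums
  bitSumsStage = withFalse ⨾ forEachFin n (λ l → mapInputs (columnInput l) (bitSumsGadget B))

  -- Columns are split into q groups of s positions; surplus positions repeat columns, which is
  -- harmless for an OR.
  column : Fin q → Fin s → Fin n
  column G p = toℕ (combine G p) mod n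

  column-surjective : ∀ l → ∃ λ G → ∃ λ p → column G p ≡ l
  column-surjective l with combine-surjective {q} {s} (inject≤ l n≤q*s)
  ... | G , p , eq = G , p , toℕ-injective (begin
    toℕ (column G p)             ≡⟨ toℕ-fromℕ< _ ⟩
    toℕ (combine G p) % n        ≡⟨ cong (λ y → toℕ y % n) eq ⟩
    toℕ (inject≤ l n≤q*s) % n    ≡⟨ cong (_% n) (toℕ-inject≤ l n≤q*s) ⟩
    toℕ l % n                    ≡⟨ m<n⇒m%n≡m (toℕ<n l) ⟩
    toℕ l                        ∎)
    where open ≡-Reasoning

  rowSubset : Fin n → Fin q → Subset s
  rowSubset k G = Vec.tabulate (A k ∘ column G)

  TableIndex RowSumIndex : Set
  TableIndex  = Fin B × (Bool × (Fin q × (Subset s × ⊤)))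
  RowSumIndex = Fin B × (Bool × (Fin n × ⊤))

  tableEntry : (Fin n × Selector B → Bool) → TableIndex → Bool
  tableEntry W (b , d , G , S , _) = any (λ p → W (column G p , inj₂ (b , d))) (members S)

  rowQuery : Fin B → Bool → Fin n → List TableIndex
  rowQuery b d k = tabulate (λ G → b , d , G , rowSubset k G , tt)

  rowSums : (TableIndex → Bool) → RowSumIndex → Bool
  rowSums t (b , d , k , _) = any t (rowQuery b d k)

  rowSums⁻ : ∀ W b d k → T (rowSums (tableEntry W) (b , d , k , tt)) →
             ∃ λ l → T (A k l) × T (W (l , inj₂ (b , d)))
  rowSums⁻ W b d k t with tabulate⁻ (any⁻ _ _ t)
  ... | G , t′ with any-∈⁻ _ (members (rowSubset k G)) t′
  ...   | p , p∈S , t″ = column G p , subst T (lookup∘tabulate (A k ∘ column G) p) (members⁻ (rowSubset k G) p∈S) , t″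

  rowSums⁺ : ∀ W b d k l → T (A k l) → T (W (l , inj₂ (b , d))) → T (rowSums (tableEntry W) (b , d , k , tt))
  rowSums⁺ W b d k l Akl t with column-surjective l
  ... | G , p , refl = any⁺ _ (tabulate⁺ G (any-∈⁺ _ (members⁺ (rowSubset k G) Sp) t))
    where
    Sp : T (lookup (rowSubset k G) p)
    Sp = subst T (sym (lookup∘tabulate (A k ∘ column G) p)) Akl

  rowSumsStage : Gadget (Fin n × Selector B) RowSumIndex
                        (B * (q * (2 ^ s * s) + q * (2 ^ s * s)) + B * (n * q + n * q)) (rowSums ∘ tableEntry)
  rowSumsStage = tables ⨾ queries
    where
    tables : Gadget (Fin n × Selector B) TableIndex (B * (q * (2 ^ s * s) + q * (2 ^ s * s))) tableEntry
    tables = forEachFin B (λ b → forEachBool (λ d → forEachFin q (λ G →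
               mapInputs (λ p → column G p , inj₂ (b , d)) (subsetSums s))))
    queries : Gadget TableIndex RowSumIndex (B * (n * q + n * q)) rowSums
    queries = forEachFin B (λ b → forEachBool (λ d → forEachFin n (λ k →
                weaken (≤-reflexive (length-tabulate {n = q} _)) (orGate (rowQuery b d k)))))

  mismatchInput : Fin n → Selector B → RowSumIndex ⊎ ⊤
  mismatchInput k (inj₁ tt)      = inj₂ tt
  mismatchInput k (inj₂ (b , d)) = inj₁ (b , d , k , tt)

  mismatches : (RowSumIndex → Bool) → Fin n × Bits B → Bool
  mismatches V (k , w) = mismatch B ([ V , (λ _ → false) ] ∘ mismatchInput k) w

  mismatchStage : Gadget RowSumIndex (Fin n × Bits B) (0 + n * mismatchCost B) mismatches
  mismatchStage = withFalse ⨾ forEachFin n (λ k → mapInputs (mismatchInput k) (mismatchGadget B))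

  offDiagonalSums : (Fin (n * n) → Bool) → Fin n × Bits B → Bool
  offDiagonalSums = mismatches ∘ rowSums ∘ tableEntry ∘ columnSums

  offDiagonalSums⁻ : ∀ x i k → T (offDiagonalSums x (k , encode i)) →
                     ∃ λ j → ∃ λ l → i ≢ j × T (A k l) × T (x (combine j l))
  offDiagonalSums⁻ x i k t with mismatch⁻ B _ (encode i) t
  ... | inj₂ (b , t′) with rowSums⁻ (columnSums x) b _ k t′
  ...   | l , Akl , t″ with columnSums⁻ x l b _ t″
  ...     | j , j[b]≡¬i[b] , xjl = j , l , (λ { refl → not-¬ refl j[b]≡¬i[b] }) , Akl , xjl

  offDiagonalSums⁺ : ∀ x i k j l → i ≢ j → T (A k l) → T (x (combine j l)) → T (offDiagonalSums x (k , encode i))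
  offDiagonalSums⁺ x i k j l i≢j Akl xjl with differingBit (encode i) (encode j) (i≢j ∘ encode-injective)
  ... | b , j[b]≡¬i[b] = mismatch⁺ B _ (encode i) (inj₂ (b , rowSums⁺ (columnSums x) b _ k l Akl xbit))
    where
    xbit : T (columnSums x (l , inj₂ (b , not (lookup (encode i) b))))
    xbit = subst (λ d → T (columnSums x (l , inj₂ (b , d)))) j[b]≡¬i[b] (columnSums⁺ x l j xjl b)

  offDiagonalGadget : Gadget (Fin (n * n)) (Fin n × Bits B) (228 * (n * n)) offDiagonalSums
  offDiagonalGadget = weaken cost-bound (bitSumsStage ⨾ rowSumsStage ⨾ mismatchStage)
    where
    collect : ∀ z → 40 * z + (172 * z + 16 * z) ≡ 228 * z
    collect = solve-∀
    cost-bound : n * bitSumsCost B + ((B * (q * (2 ^ s * s) + q * (2 ^ s * s)) + B * (n * q + n * q)) + n * mismatchCost B)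
                 ≤ 228 * (n * n)
    cost-bound = ≤-trans (+-mono-≤ bitSumsStage-cost (+-mono-≤ rowSumsStage-cost mismatchStage-cost))
                         (≤-reflexive (collect (n * n)))

  rowNode : Fin (n * n) → Fin n × Bits B
  rowNode r = remainder {n} n r , encode (quotient {n} n r)

  Ibar⊗A-circuit : C∨≤ (Ibar n ⊗ A) (228 * (n * n))
  Ibar⊗A-circuit = record { gates = gates′ E ; circuit = circuit′ E ; output = output E ∘ rowNode ; correct = correct }
                 , size-≤ E
    where
    E : Extension [] inj₁ (228 * (n * n)) offDiagonalSums
    E = offDiagonalGadget [] inj₁
    correct : ∀ x r → evalNode (circuit′ E) x (output E (rowNode r)) ≡ rowOr (Ibar n ⊗ A) r x
    correct x r = trans (output-eval E x (λ _ → refl) (rowNode r)) (T-ext sound complete)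
      where
      sound : T (offDiagonalSums x (rowNode r)) → T (rowOr (Ibar n ⊗ A) r x)
      sound t with offDiagonalSums⁻ x (quotient {n} n r) (remainder {n} n r) t
      ... | j , l , i≢j , Akl , xjl = rowOr-Ibar⊗⁺ A r x j l i≢j Akl xjl
      complete : T (rowOr (Ibar n ⊗ A) r x) → T (offDiagonalSums x (rowNode r))
      complete t with rowOr-Ibar⊗⁻ A r x t
      ... | j , l , i≢j , Akl , xjl = offDiagonalSums⁺ x (quotient {n} n r) (remainder {n} n r) j l i≢j Akl xjl

lemma9 : ∃[ C ] ∀ (n : ℕ) (A : Matrix n n) → C∨≤ (Ibar n ⊗ A) (C * (n * n))
lemma9 = 228 , Ibar⊗-circuit
  where
  Ibar⊗-circuit : ∀ n (A : Matrix n n) → C∨≤ (Ibar n ⊗ A) (228 * (n * n))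
  Ibar⊗-circuit zero     A = record { gates = 0 ; circuit = [] ; output = λ () ; correct = λ _ () } , z≤n
  Ibar⊗-circuit (suc n′) A with powerOfFour-between n′
  ... | h , n≤X , X≤4n = Construction.Ibar⊗A-circuit n′ h n≤X X≤4n A
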